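{- Let $G=C(m,n;k,l;c,d)$ be a $C$-shaped supergrid graph (with $m\geqslant 2$, $n\geqslant 3$, $k,l,c\geqslant 1$, $a=m-k\geqslant 1$, $d=n-l-c\geqslant 1$) and let $s,t$ be two distinct vertices of $G$, labeled so that $s_x\leqslant t_x$. If $G$ has a Hamiltonian path from $s$ to $t$, then $(G,s,t)$ satisfies none of the conditions (F1), (F3), (F7), (F8), (F9) defined below.
   Context: The supergrid graph on a finite set $V\subset\mathbb{Z}^2$ has vertex set $V$, two distinct vertices $u,v$ adjacent iff $|u_x-v_x|\leqslant 1$ and $|u_y-v_y|\leqslant 1$. $R(m,n)$ is the supergrid graph on $\{(x,y):1\leqslant x\leqslant m, 1\leqslant y\leqslant n\}$. $C(m,n;k,l;c,d)$ is the supergrid graph on $V(R(m,n))\setminus\{(x,y): a+1\leqslant x\leqslant m,\ c+1\leqslant y\leqslant c+l\}$, where $a=m-k$, $d=n-l-c$. Conditions on $(G,s,t)$: (F1) $s$ or $t$ is a cut vertex of $G$, or $\{s,t\}$ is a vertex cut of $G$ (i.e. $G-\{s,t\}$ is disconnected). (F3) there is a vertex $w\notin\{s,t\}$ with $\deg(w)=1$. (F7) $m=3$, $a=2$, and either ($c=1$ and $\{s,t\}=\{(1,1),(2,2)\}$ or $\{(1,2),(2,1)\}$) or ($d=1$ and $\{s,t\}=\{(1,n),(2,n-1)\}$ or $\{(1,n-1),(2,n)\}$). (F8) $n=3$, $k=c=d=1$, and (1) $a\geqslant 2$, $s_x=t_x=m-1$, $|s_y-t_y|=2$; or (2) $a=2$,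 $s_x=1$, $t_x=2$, $|s_y-t_y|=2$; or (3) $a>2$, $s_x<m-1$, and $t=(m-1,2)$. (F9) $a=1$, and ($s_y,t_y\leqslant c$ or $s_y,t_y>c+l$). -}

module Defs where

open import Data.Nat using (ℕ; _+_; _∸_; _≤_; _<_; ∣_-_∣)
open import Data.Product using (Σ; ∃; _×_; _,_; proj₁; proj₂)
open import Data.Sum using (_⊎_)
open import Data.List using (List; []; _∷_; _∷ʳ_)
open import Data.List.Membership.Propositional using (_∈_)
open import Data.List.Relation.Unary.All using (All)
open import Data.List.Relation.Unary.Unique.Propositional using (Unique)
open import Data.List.Relation.Unary.Linked using (Linked)
open import Relation.Nullary using (¬_)
open import Relation.Binary.PropositionalEquality using (_≡_; _≢_)

-- Points of ℤ² with positive coordinates; all vertex sets used here lie in ℕ².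
Pt : Set
Pt = ℕ × ℕ

VSet : Set₁
VSet = Pt → Set

Adj : Pt → Pt → Set
Adj u v = u ≢ v × ∣ proj₁ u - proj₁ v ∣ ≤ 1 × ∣ proj₂ u - proj₂ v ∣ ≤ 1

InR : ℕ → ℕ → VSet
InR m n (x , y) = 1 ≤ x × x ≤ m × 1 ≤ y × y ≤ n

-- Vertex set of C(m,n;k,l;c,d), with a = m - k (d = n - l - c is determined).
InC : ℕ → ℕ → ℕ → ℕ → ℕ → VSet
InC m n k l c (x , y) =
  InR m n (x , y) × ¬ ((m ∸ k) + 1 ≤ x × x ≤ m × c + 1 ≤ y × y ≤ c + l)

_─_ : VSet → (Pt → Set) → VSet
(V ─ X) v = V v × ¬ X v

Walk : VSet → Pt → Pt → List Pt → Set
Walk V u w ps =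
  All V ps × Linked Adj ps
  × (Σ (List Pt) λ rest → ps ≡ u ∷ rest)
  × (Σ (List Pt) λ ini → ps ≡ ini ∷ʳ w)

Connected : VSet → Set
Connected V = ∀ u w → V u → V w → Σ (List Pt) λ ps → Walk V u w ps

Disconnected : VSet → Set
Disconnected V = ¬ Connected V

HamPath : VSet → Pt → Pt → Set
HamPath V s t =
  Σ (List Pt) λ ps → Walk V s t ps × Unique ps × (∀ v → V v → v ∈ ps)

IsCutVertex : VSet → Pt → Set
IsCutVertex V w = V w × Disconnected (V ─ (λ v → v ≡ w))

IsVertexCut2 : VSet → Pt → Pt → Set
IsVertexCut2 V s t = Disconnected (V ─ (λ v → v ≡ s ⊎ v ≡ t))

Deg1 : VSet → Pt → Set
Deg1 V w = Σ Pt λ u → V u × Adj w u × (∀ v → V v → Adj w v → v ≡ u)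

PairEq : Pt → Pt → Pt → Pt → Set
PairEq s t p q = (s ≡ p × t ≡ q) ⊎ (s ≡ q × t ≡ p)

module _ (m n k l c : ℕ) (s t : Pt) where
  private
    a d sx sy tx ty : ℕ
    a = m ∸ k
    d = n ∸ (l + c)
    sx = proj₁ s
    sy = proj₂ s
    tx = proj₁ t
    ty = proj₂ t
    G : VSet
    G = InC m n k l c

  F1 : Set
  F1 = IsCutVertex G s ⊎ IsCutVertex G t ⊎ IsVertexCut2 G s t

  F3 : Set
  F3 = Σ Pt λ w → G w × w ≢ s × w ≢ t × Deg1 G w

  F7 : Set
  F7 = m ≡ 3 × a ≡ 2 ×
       ( (c ≡ 1 × (PairEq s t (1 , 1) (2 , 2) ⊎ PairEq s t (1 , 2) (2 , 1)))
       ⊎ (d ≡ 1 × (PairEq s t (1 , n) (2 , n ∸ 1) ⊎ PairEq s t (1 , n ∸ 1) (2 , n))))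

  F8 : Set
  F8 = n ≡ 3 × k ≡ 1 × c ≡ 1 × d ≡ 1 ×
       ( (2 ≤ a × sx ≡ m ∸ 1 × tx ≡ m ∸ 1 × ∣ sy - ty ∣ ≡ 2)
       ⊎ (a ≡ 2 × sx ≡ 1 × tx ≡ 2 × ∣ sy - ty ∣ ≡ 2)
       ⊎ (2 < a × sx < m ∸ 1 × t ≡ (m ∸ 1 , 2)))

  F9 : Set
  F9 = a ≡ 1 × ((sy ≤ c × ty ≤ c) ⊎ (c + l < sy × c + l < ty))

{-# OPTIONS --safe #-}
-- A Hamiltonian s–t path is encoded by its successor relation u ↦ v, which is functional, injective
-- and acyclic, reaches every vertex from s and reaches t from every vertex.  Deleting s, t or both
-- leaves a graph still spanned by a segment of the path, so (F1) fails; an internal vertex needs a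
-- predecessor and a successor, so it cannot have degree 1 (F3).  In (F7) and (F8) the corners of a
-- short arm have degree 2, so their path neighbours are forced; the forced segments either run
-- from s to t while missing a vertex, or leave some vertex with a single usable neighbour.  In
-- (F9) the vertex of the column x = 1 next to the notch separates the arm holding s and t from
-- the other arm, and the path would have to pass through it twice.
module Submission where

open import Defs
open import Data.Nat using (ℕ; zero; suc; _+_; _∸_; _≤_; _<_; z≤n; s≤s; s≤s⁻¹; ∣_-_∣; _≟_)
open import Data.Nat.Properties
open import Data.Product using (Σ; _×_; _,_; proj₁; proj₂; map₂)
open import Data.Product.Properties using (≡-dec)
open import Data.Sum using (_⊎_; inj₁; inj₂; [_,_]′)
open import Data.Empty using (⊥; ⊥-elim)
open import Data.Unit using (⊤)
open import Data.List using (List; []; _∷_; _∷ʳ_)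
open import Data.List.Membership.Propositional using (_∈_)
open import Data.List.Membership.Propositional.Properties using (∈-++⁻; ∈-++⁺ʳ)
open import Data.List.Relation.Unary.Any using (here; there)
open import Data.List.Relation.Unary.All as All using (All; []; _∷_; lookup)
open import Data.List.Relation.Unary.All.Properties using (All¬⇒¬Any)
open import Data.List.Relation.Unary.AllPairs using (_∷_)
open import Data.List.Relation.Unary.Unique.Propositional using (Unique)
open import Data.List.Relation.Unary.Linked using (Linked; [-]; _∷_)
open import Relation.Nullary using (¬_; Dec; yes; no)
open import Relation.Nullary.Decidable using (_⊎-dec_)
open import Relation.Binary using (DecidableEquality; tri<; tri≈; tri>)
open import Relation.Binary.PropositionalEquality

_≟ₚ_ : DecidableEquality Pt
_≟ₚ_ = ≡-dec _≟_ _≟_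

Adj-sym : ∀ {u v} → Adj u v → Adj v u
Adj-sym {u} {v} (u≢v , dx , dy) =
  (λ v≡u → u≢v (sym v≡u)) ,
  subst (_≤ 1) (∣-∣-comm (proj₁ u) (proj₁ v)) dx ,
  subst (_≤ 1) (∣-∣-comm (proj₂ u) (proj₂ v)) dy

head∉tail : ∀ {x : Pt} {xs} → Unique (x ∷ xs) → ¬ x ∈ xs
head∉tail (x∉ ∷ _) = All¬⇒¬Any x∉

data Consecutive (u v : Pt) : List Pt → Set where
  at-head : ∀ {L} → Consecutive u v (u ∷ v ∷ L)
  further : ∀ {x L} → Consecutive u v L → Consecutive u v (x ∷ L)

module _ {u v : Pt} where

  fst∈ : ∀ {L} → Consecutive u v L → u ∈ L
  fst∈ at-head = here refl
  fst∈ (further c) = there (fst∈ c)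

  snd∈tail : ∀ {x L} → Consecutive u v (x ∷ L) → v ∈ L
  snd∈tail at-head = here refl
  snd∈tail {L = _ ∷ _} (further c) = there (snd∈tail c)

  linked⇒ : ∀ {R : Pt → Pt → Set} {L} → Linked R L → Consecutive u v L → R u v
  linked⇒ (r ∷ _) at-head = r
  linked⇒ (_ ∷ rs) (further c) = linked⇒ rs c
  linked⇒ [-] (further ())

  all⇒ : ∀ {P : Pt → Set} {L} → All P L → Consecutive u v L → P u × P v
  all⇒ (pu ∷ pv ∷ _) at-head = pu , pv
  all⇒ (_ ∷ ps) (further c) = all⇒ ps c

consecutive-functional : ∀ {u v v' L} → Unique L → Consecutive u v L → Consecutive u v' L → v ≡ v'
consecutive-functional _ at-head at-head = refl
consecutive-functional un at-head (further c) = ⊥-elim (head∉tail un (fst∈ c))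
consecutive-functional un (further c) at-head = ⊥-elim (head∉tail un (fst∈ c))
consecutive-functional (_ ∷ un) (further c) (further c') = consecutive-functional un c c'

consecutive-injective : ∀ {u u' v L} → Unique L → Consecutive u v L → Consecutive u' v L → u ≡ u'
consecutive-injective _ at-head at-head = refl
consecutive-injective (_ ∷ un) at-head (further c) = ⊥-elim (head∉tail un (snd∈tail c))
consecutive-injective (_ ∷ un) (further c) at-head = ⊥-elim (head∉tail un (snd∈tail c))
consecutive-injective (_ ∷ un) (further c) (further c') = consecutive-injective un c c'

consecutive-asym : ∀ {u v L} → Unique L → Consecutive u v L → ¬ Consecutive v u L
consecutive-asym un at-head c = head∉tail un (snd∈tail c)
consecutive-asym un (further c) at-head = head∉tail un (there (snd∈tail c))
consecutive-asym (_ ∷ un) (further c) (further c') = consecutive-asym un c c'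

∈tail⇒has-predecessor : ∀ h L {w} → w ∈ L → Σ Pt λ p → Consecutive p w (h ∷ L)
∈tail⇒has-predecessor h (_ ∷ L) (here refl) = h , at-head
∈tail⇒has-predecessor h (y ∷ L) (there w∈L) = map₂ further (∈tail⇒has-predecessor y L w∈L)

∈init⇒has-successor : ∀ ini t {w} → w ∈ ini → Σ Pt λ q → Consecutive w q (ini ∷ʳ t)
∈init⇒has-successor (_ ∷ []) t (here refl) = t , at-head
∈init⇒has-successor (_ ∷ y ∷ ini) t (here refl) = y , at-head
∈init⇒has-successor (_ ∷ ini) t (there w∈ini) = map₂ further (∈init⇒has-successor ini t w∈ini)

last-has-no-successor : ∀ ini {t q} → Unique (ini ∷ʳ t) → ¬ Consecutive t q (ini ∷ʳ t)
last-has-no-successor [] _ (further ())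
last-has-no-successor (_ ∷ []) un at-head = head∉tail un (here refl)
last-has-no-successor (_ ∷ []) _ (further (further ()))
last-has-no-successor (_ ∷ y ∷ ini) un at-head = head∉tail un (∈-++⁺ʳ (y ∷ ini) (here refl))
last-has-no-successor (_ ∷ y ∷ ini) (_ ∷ un) (further c) = last-has-no-successor (y ∷ ini) un c

all-from-head : ∀ (S : Pt → Set) h L → S h
              → (∀ {u v} → Consecutive u v (h ∷ L) → S u → S v) → All S (h ∷ L)
all-from-head S h [] Sh step = Sh ∷ []
all-from-head S h (y ∷ L) Sh step = Sh ∷ all-from-head S y L (step at-head Sh) (λ c → step (further c))

all-from-last : ∀ (S : Pt → Set) ini t → S t
              → (∀ {u v} → Consecutive u v (ini ∷ʳ t) → S v → S u) → All S (ini ∷ʳ t)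
all-from-last S [] t St step = St ∷ []
all-from-last S (_ ∷ []) t St step = step at-head St ∷ St ∷ []
all-from-last S (_ ∷ y ∷ ini) t St step with all-from-last S (y ∷ ini) t St (λ c → step (further c))
... | Sy ∷ Srest = step at-head Sy ∷ Sy ∷ Srest

record HamiltonianOrder (V : VSet) (s t : Pt) : Set₁ where
  field
    _↦_ : Pt → Pt → Set
    ↦⇒adj : ∀ {u v} → u ↦ v → Adj u v
    ↦⇒∈V : ∀ {u v} → u ↦ v → V u × V v
    start∈V : V s
    ↦-functional : ∀ {u v v'} → u ↦ v → u ↦ v' → v ≡ v'
    ↦-injective : ∀ {u u' v} → u ↦ v → u' ↦ v → u ≡ u'
    ↦-asym : ∀ {u v} → u ↦ v → ¬ v ↦ u
    ¬↦start : ∀ {u} → ¬ u ↦ s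
    ¬end↦ : ∀ {v} → ¬ t ↦ v
    predecessor : ∀ {w} → V w → w ≢ s → Σ Pt (_↦ w)
    successor : ∀ {w} → V w → w ≢ t → Σ Pt (w ↦_)
    forward-induction : (S : Pt → Set) → S s → (∀ {u v} → u ↦ v → S u → S v) → ∀ z → V z → S z
    backward-induction : (S : Pt → Set) → S t → (∀ {u v} → u ↦ v → S v → S u) → ∀ z → V z → S z

hamPath⇒order : ∀ {V s t} → HamPath V s t → HamiltonianOrder V s t
hamPath⇒order {V} {s} {t} (_ , (allV , linked , (rest , refl) , (ini , ps≡)) , unique , covers) = record
  { _↦_ = λ u v → Consecutive u v (s ∷ rest)
  ; ↦⇒adj = linked⇒ linked
  ; ↦⇒∈V = all⇒ allV
  ; start∈V = All.head allV
  ; ↦-functional = consecutive-functional unique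
  ; ↦-injective = consecutive-injective unique
  ; ↦-asym = consecutive-asym unique
  ; ¬↦start = λ c → head∉tail unique (snd∈tail c)
  ; ¬end↦ = λ {v} c → last-has-no-successor ini (subst Unique ps≡ unique) (subst (Consecutive t v) ps≡ c)
  ; predecessor = predecessor
  ; successor = successor
  ; forward-induction = λ S Ss step z Vz → lookup (all-from-head S s rest Ss step) (covers z Vz)
  ; backward-induction = λ S St step z Vz →
      lookup (all-from-last S ini t St (λ {u} {v} c → step (subst (Consecutive u v) (sym ps≡) c)))
             (subst (z ∈_) ps≡ (covers z Vz))
  }
  where
  predecessor : ∀ {w} → V w → w ≢ s → Σ Pt λ p → Consecutive p w (s ∷ rest)
  predecessor {w} Vw w≢s with covers w Vw
  ... | here w≡s = ⊥-elim (w≢s w≡s)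
  ... | there w∈rest = ∈tail⇒has-predecessor s rest w∈rest
  successor : ∀ {w} → V w → w ≢ t → Σ Pt λ q → Consecutive w q (s ∷ rest)
  successor {w} Vw w≢t with ∈-++⁻ ini (subst (w ∈_) ps≡ (covers w Vw))
  ... | inj₂ (here w≡t) = ⊥-elim (w≢t w≡t)
  ... | inj₁ w∈ini = map₂ (subst (Consecutive w _) (sym ps≡)) (∈init⇒has-successor ini t w∈ini)

data Path (V : VSet) : Pt → Pt → Set where
  stop : ∀ {u} → V u → Path V u u
  step : ∀ {u v w} → V u → Adj u v → Path V v w → Path V u w

module _ {V : VSet} where

  snoc : ∀ {u v w} → Path V u v → Adj v w → V w → Path V u w
  snoc (stop Vu) a Vw = step Vu a (stop Vw)
  snoc (step Vu a p) a' Vw = step Vu a (snoc p a' Vw)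

  _++ᵖ_ : ∀ {u v w} → Path V u v → Path V v w → Path V u w
  stop _ ++ᵖ q = q
  step Vu a p ++ᵖ q = step Vu a (p ++ᵖ q)

  reverse : ∀ {u w} → Path V u w → Path V w u
  reverse (stop Vu) = stop Vu
  reverse (step Vu a p) = snoc (reverse p) (Adj-sym a) Vu

  vertices : ∀ {u w} → Path V u w → List Pt
  vertices (stop {u} _) = u ∷ []
  vertices (step {u} _ _ p) = u ∷ vertices p

  path⇒walk : ∀ {u w} (p : Path V u w) → Walk V u w (vertices p)
  path⇒walk p = all p , linked p , starts p , ends p
    where
    all : ∀ {u w} (p : Path V u w) → All V (vertices p)
    all (stop Vu) = Vu ∷ []
    all (step Vu _ p) = Vu ∷ all p
    linked : ∀ {u w} (p : Path V u w) → Linked Adj (vertices p)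
    linked (stop _) = [-]
    linked (step _ a (stop _)) = a ∷ [-]
    linked (step _ a p@(step _ _ _)) = a ∷ linked p
    starts : ∀ {u w} (p : Path V u w) → Σ (List Pt) λ rest → vertices p ≡ u ∷ rest
    starts (stop _) = [] , refl
    starts (step _ _ p) = vertices p , refl
    ends : ∀ {u w} (p : Path V u w) → Σ (List Pt) λ ini → vertices p ≡ ini ∷ʳ w
    ends (stop _) = [] , refl
    ends (step {u} _ _ p) = let ini , eq = ends p in u ∷ ini , cong (u ∷_) eq

  rooted⇒connected : ∀ {b} → (∀ z → V z → Path V b z) → Connected V
  rooted⇒connected path-to u w Vu Vw = _ , path⇒walk (reverse (path-to u Vu) ++ᵖ path-to w Vw)

NeighboursIn : VSet → Pt → List Pt → Set
NeighboursIn V w L = ∀ v → V v → Adj w v → v ∈ L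

NeighboursIn-swap : ∀ {V w A B} → NeighboursIn V w (A ∷ B ∷ []) → NeighboursIn V w (B ∷ A ∷ [])
NeighboursIn-swap nb v Vv a with nb v Vv a
... | here v≡A = there (here v≡A)
... | there (here v≡B) = here v≡B

module OrderFacts {V : VSet} {s t : Pt} (H : HamiltonianOrder V s t) where
  open HamiltonianOrder H public

  Internal : Pt → Set
  Internal w = V w × w ≢ s × w ≢ t

  predecessor∈ : ∀ {w p L} → NeighboursIn V w L → p ↦ w → p ∈ L
  predecessor∈ nb p↦w = nb _ (proj₁ (↦⇒∈V p↦w)) (Adj-sym (↦⇒adj p↦w))

  successor∈ : ∀ {w q L} → NeighboursIn V w L → w ↦ q → q ∈ L
  successor∈ nb w↦q = nb _ (proj₂ (↦⇒∈V w↦q)) (↦⇒adj w↦q)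

  ¬internal-degree1 : ¬ (Σ Pt λ w → V w × w ≢ s × w ≢ t × Deg1 V w)
  ¬internal-degree1 (w , Vw , w≢s , w≢t , u , _ , _ , only-u) with predecessor Vw w≢s | successor Vw w≢t
  ... | p , p↦w | q , w↦q = ↦-asym p↦w (subst (w ↦_) q≡p w↦q)
    where
    q≡p : q ≡ p
    q≡p = trans (only-u q (proj₂ (↦⇒∈V w↦q)) (↦⇒adj w↦q))
                (sym (only-u p (proj₁ (↦⇒∈V p↦w)) (Adj-sym (↦⇒adj p↦w))))

  -- Every vertex outside X is reached from b along the path, which re-enters V ─ X from X only at b.
  connected-minus : (X : Pt → Set) → (∀ v → Dec (X v)) → (b : Pt) → X s ⊎ Path (V ─ X) b s
                  → (∀ {u v} → u ↦ v → X u → ¬ X v → v ≡ b) → Connected (V ─ X)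
  connected-minus X X? b Ss enter-at-b = rooted⇒connected path-from-b
    where
    S : Pt → Set
    S v = X v ⊎ Path (V ─ X) b v
    S-step : ∀ {u v} → u ↦ v → S u → S v
    S-step {v = v} u↦v Su with X? v
    ... | yes Xv = inj₁ Xv
    S-step {v = v} u↦v (inj₁ Xu) | no ¬Xv =
      inj₂ (subst (λ x → Path (V ─ X) x v) (enter-at-b u↦v Xu ¬Xv) (stop (proj₂ (↦⇒∈V u↦v) , ¬Xv)))
    S-step u↦v (inj₂ p) | no ¬Xv = inj₂ (snoc p (↦⇒adj u↦v) (proj₂ (↦⇒∈V u↦v) , ¬Xv))
    path-from-b : ∀ z → (V ─ X) z → Path (V ─ X) b z
    path-from-b z (Vz , ¬Xz) with forward-induction S Ss S-step z Vz
    ... | inj₁ Xz = ⊥-elim (¬Xz Xz)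
    ... | inj₂ p = p

  connected-without-start : s ≢ t → Connected (V ─ (λ v → v ≡ s))
  connected-without-start s≢t with successor start∈V s≢t
  ... | b , s↦b = connected-minus _ (_≟ₚ s) b (inj₁ refl)
                    (λ { u↦v refl _ → ↦-functional u↦v s↦b })

  connected-without-end : s ≢ t → Connected (V ─ (λ v → v ≡ t))
  connected-without-end s≢t = connected-minus _ (_≟ₚ t) s (inj₂ (stop (start∈V , s≢t)))
                                (λ { u↦v refl _ → ⊥-elim (¬end↦ u↦v) })

  connected-without-ends : s ≢ t → Connected (V ─ (λ v → v ≡ s ⊎ v ≡ t))
  connected-without-ends s≢t with successor start∈V s≢t
  ... | b , s↦b = connected-minus _ (λ v → (v ≟ₚ s) ⊎-dec (v ≟ₚ t)) b (inj₁ (inj₁ refl))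
                    (λ { u↦v (inj₁ refl) _ → ↦-functional u↦v s↦b
                       ; u↦v (inj₂ refl) _ → ⊥-elim (¬end↦ u↦v) })

  through : ∀ {w A B} → Internal w → NeighboursIn V w (A ∷ B ∷ [])
          → (A ↦ w × w ↦ B) ⊎ (B ↦ w × w ↦ A)
  through (Vw , w≢s , w≢t) nb with predecessor Vw w≢s | successor Vw w≢t
  ... | p , p↦w | q , w↦q with predecessor∈ nb p↦w | successor∈ nb w↦q
  ... | here refl | here refl = ⊥-elim (↦-asym p↦w w↦q)
  ... | here refl | there (here refl) = inj₁ (p↦w , w↦q)
  ... | there (here refl) | here refl = inj₂ (p↦w , w↦q)
  ... | there (here refl) | there (here refl) = ⊥-elim (↦-asym p↦w w↦q)

  start↦ : ∀ {w B} → Internal w → NeighboursIn V w (s ∷ B ∷ []) → s ↦ w × w ↦ B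
  start↦ i nb with through i nb
  ... | inj₁ path = path
  ... | inj₂ (_ , w↦s) = ⊥-elim (¬↦start w↦s)

  ↦end : ∀ {w A} → Internal w → NeighboursIn V w (A ∷ t ∷ []) → A ↦ w × w ↦ t
  ↦end i nb with through i nb
  ... | inj₁ path = path
  ... | inj₂ (t↦w , _) = ⊥-elim (¬end↦ t↦w)

  Chain : List Pt → Set
  Chain [] = ⊤
  Chain (x ∷ []) = x ≡ t
  Chain (x ∷ y ∷ r) = x ↦ y × Chain (y ∷ r)

  chain⇒covers : ∀ r → Chain (s ∷ r) → ∀ z → V z → z ∈ s ∷ r
  chain⇒covers r ch = forward-induction (_∈ s ∷ r) (here refl) (closed s r ch)
    where
    closed : ∀ x r → Chain (x ∷ r) → ∀ {u v} → u ↦ v → u ∈ x ∷ r → v ∈ x ∷ r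
    closed x [] refl u↦v (here refl) = ⊥-elim (¬end↦ u↦v)
    closed x (y ∷ r) (x↦y , _) u↦v (here refl) = there (here (↦-functional u↦v x↦y))
    closed x (y ∷ r) (_ , ch) u↦v (there u∈) = there (closed y r ch u↦v u∈)

  F8₁-pattern-covers : ∀ {w₁ c w₃} → Internal w₁ → Internal w₃
                     → NeighboursIn V w₁ (s ∷ c ∷ []) → NeighboursIn V w₃ (c ∷ t ∷ [])
                     → ∀ z → V z → z ∈ s ∷ w₁ ∷ c ∷ w₃ ∷ t ∷ []
  F8₁-pattern-covers i₁ i₃ nb₁ nb₃ =
    let s↦w₁ , w₁↦c = start↦ i₁ nb₁
        c↦w₃ , w₃↦t = ↦end i₃ nb₃
    in chain⇒covers _ (s↦w₁ , w₁↦c , c↦w₃ , w₃↦t , refl)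

  -- C ↦ P ↦ t and Q ↦ C are forced, so Z can enter and leave only through E.
  F8₂-pattern-impossible : ∀ {P Q Z C D E} → Internal P → Internal Q → Internal Z
                         → Z ≢ P → Z ≢ Q → P ≢ Q
                         → NeighboursIn V P (C ∷ t ∷ []) → NeighboursIn V Q (D ∷ C ∷ [])
                         → NeighboursIn V Z (E ∷ C ∷ t ∷ []) → ⊥
  F8₂-pattern-impossible iP iQ (VZ , Z≢s , Z≢t) Z≢P Z≢Q P≢Q nbP nbQ nbZ with ↦end iP nbP
  ... | C↦P , P↦t with through iQ nbQ
  ... | inj₂ (C↦Q , _) = P≢Q (↦-functional C↦P C↦Q)
  ... | inj₁ (_ , Q↦C) with predecessor VZ Z≢s | successor VZ Z≢t
  ... | p , p↦Z | q , Z↦q with predecessor∈ nbZ p↦Z | successor∈ nbZ Z↦q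
  ... | _ | there (here refl) = Z≢Q (↦-injective Z↦q Q↦C)
  ... | _ | there (there (here refl)) = Z≢P (↦-injective Z↦q P↦t)
  ... | there (here refl) | _ = Z≢P (↦-functional p↦Z C↦P)
  ... | there (there (here refl)) | _ = ¬end↦ p↦Z
  ... | here refl | here refl = ↦-asym p↦Z Z↦q

  F7₁-pattern-covers : ∀ {W D E} → s ≢ t → Internal W → Internal D → D ≢ E
                     → NeighboursIn V W (D ∷ t ∷ []) → NeighboursIn V s (D ∷ E ∷ t ∷ [])
                     → NeighboursIn V D (s ∷ W ∷ E ∷ t ∷ [])
                     → ∀ z → V z → z ∈ s ∷ D ∷ W ∷ t ∷ [] ⊎ z ∈ s ∷ E ∷ D ∷ W ∷ t ∷ []
  F7₁-pattern-covers s≢t iW@(_ , W≢s , _) (VD , D≢s , D≢t) D≢E nbW nbs nbD z Vz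
    with ↦end iW nbW | successor start∈V s≢t
  ... | D↦W , W↦t | x , s↦x with successor∈ nbs s↦x
  ... | there (there (here refl)) = ⊥-elim (W≢s (↦-injective W↦t s↦x))
  ... | here refl = inj₁ (chain⇒covers _ (s↦x , D↦W , W↦t , refl) z Vz)
  ... | there (here refl) with predecessor VD D≢s
  ... | p , p↦D with predecessor∈ nbD p↦D
  ... | here refl = ⊥-elim (D≢E (↦-functional p↦D s↦x))
  ... | there (here refl) = ⊥-elim (D≢t (↦-functional p↦D W↦t))
  ... | there (there (here refl)) = inj₂ (chain⇒covers _ (s↦x , p↦D , D↦W , W↦t , refl) z Vz)
  ... | there (there (there (here refl))) = ⊥-elim (¬end↦ p↦D)

  F7₂-pattern-covers : ∀ {W C Y} → Internal W → Internal Y → Y ≢ W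
                     → NeighboursIn V W (C ∷ t ∷ []) → NeighboursIn V Y (t ∷ s ∷ C ∷ [])
                     → ∀ z → V z → z ∈ s ∷ Y ∷ C ∷ W ∷ t ∷ []
  F7₂-pattern-covers iW (VY , Y≢s , Y≢t) Y≢W nbW nbY z Vz with ↦end iW nbW
  ... | C↦W , W↦t with predecessor VY Y≢s | successor VY Y≢t
  ... | p , p↦Y | q , Y↦q with predecessor∈ nbY p↦Y | successor∈ nbY Y↦q
  ... | here refl | _ = ⊥-elim (¬end↦ p↦Y)
  ... | _ | there (here refl) = ⊥-elim (¬↦start Y↦q)
  ... | _ | here refl = ⊥-elim (Y≢W (↦-injective Y↦q W↦t))
  ... | there (there (here refl)) | there (there (here refl)) = ⊥-elim (↦-asym p↦Y Y↦q)
  ... | there (here refl) | there (there (here refl)) =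
    chain⇒covers _ (p↦Y , Y↦q , C↦W , W↦t , refl) z Vz

  -- The path has to cross h into Up and back, but it passes h only once.
  ends-on-one-side⇒other-side-empty :
    (Lo Up : Pt → Set) (h : Pt) → V h → (∀ v → V v → Lo v ⊎ v ≡ h ⊎ Up v)
    → ¬ Lo h → ¬ Up h → (∀ v → Lo v → ¬ Up v) → (∀ u v → Adj u v → Lo u → ¬ Up v)
    → Lo s → Lo t → ∀ z → V z → ¬ Up z
  ends-on-one-side⇒other-side-empty Lo Up h Vh split ¬Lo-h ¬Up-h Lo∩Up no-edge Lo-s Lo-t z Vz Up-z
    with predecessor Vh (λ h≡s → ¬Lo-h (subst Lo (sym h≡s) Lo-s))
       | successor Vh (λ h≡t → ¬Lo-h (subst Lo (sym h≡t) Lo-t))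
  ... | p , p↦h | q , h↦q with split p (proj₁ (↦⇒∈V p↦h)) | split q (proj₂ (↦⇒∈V h↦q))
  ... | inj₂ (inj₁ refl) | _ = proj₁ (↦⇒adj p↦h) refl
  ... | _ | inj₂ (inj₁ refl) = proj₁ (↦⇒adj h↦q) refl
  ... | inj₂ (inj₂ Up-p) | _ = ¬Lo-h (forward-induction Lo Lo-s Lo-step h Vh)
    where
    Lo-step : ∀ {u v} → u ↦ v → Lo u → Lo v
    Lo-step {u} {v} u↦v Lo-u with split v (proj₂ (↦⇒∈V u↦v))
    ... | inj₁ Lo-v = Lo-v
    ... | inj₂ (inj₁ refl) = ⊥-elim (Lo∩Up p (subst Lo (↦-injective u↦v p↦h) Lo-u) Up-p)
    ... | inj₂ (inj₂ Up-v) = ⊥-elim (no-edge u v (↦⇒adj u↦v) Lo-u Up-v)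
  ... | inj₁ Lo-p | inj₂ (inj₂ Up-q) = ¬Lo-h (backward-induction Lo Lo-t Lo-step h Vh)
    where
    Lo-step : ∀ {u v} → u ↦ v → Lo v → Lo u
    Lo-step {u} {v} u↦v Lo-v with split u (proj₁ (↦⇒∈V u↦v))
    ... | inj₁ Lo-u = Lo-u
    ... | inj₂ (inj₁ refl) = ⊥-elim (Lo∩Up q (subst Lo (↦-functional u↦v h↦q) Lo-v) Up-q)
    ... | inj₂ (inj₂ Up-u) = ⊥-elim (no-edge v u (Adj-sym (↦⇒adj u↦v)) Lo-v Up-u)
  ... | inj₁ Lo-p | inj₁ Lo-q with forward-induction S (inj₁ Lo-s) S-step z Vz
    where
    S : Pt → Set
    S v = Lo v ⊎ v ≡ h
    S-step : ∀ {u v} → u ↦ v → S u → S v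
    S-step {u} {v} u↦v (inj₁ Lo-u) with split v (proj₂ (↦⇒∈V u↦v))
    ... | inj₁ Lo-v = inj₁ Lo-v
    ... | inj₂ (inj₁ v≡h) = inj₂ v≡h
    ... | inj₂ (inj₂ Up-v) = ⊥-elim (no-edge u v (↦⇒adj u↦v) Lo-u Up-v)
    S-step u↦v (inj₂ refl) = inj₁ (subst Lo (↦-functional h↦q u↦v) Lo-q)
  ... | inj₁ Lo-z = Lo∩Up z Lo-z Up-z
  ... | inj₂ refl = ¬Up-h Up-z

Near : ℕ → ℕ → Set
Near a b = b ≡ a ⊎ b ≡ suc a ⊎ suc b ≡ a

∣-∣≤1⇒Near : ∀ a b → ∣ a - b ∣ ≤ 1 → Near a b
∣-∣≤1⇒Near zero zero _ = inj₁ refl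
∣-∣≤1⇒Near zero (suc zero) _ = inj₂ (inj₁ refl)
∣-∣≤1⇒Near zero (suc (suc b)) (s≤s ())
∣-∣≤1⇒Near (suc zero) zero _ = inj₂ (inj₂ refl)
∣-∣≤1⇒Near (suc (suc a)) zero (s≤s ())
∣-∣≤1⇒Near (suc a) (suc b) d with ∣-∣≤1⇒Near a b d
... | inj₁ e = inj₁ (cong suc e)
... | inj₂ (inj₁ e) = inj₂ (inj₁ (cong suc e))
... | inj₂ (inj₂ e) = inj₂ (inj₂ (cong suc e))

Adj⇒y≤1+y : ∀ {u v} → Adj u v → proj₂ v ≤ suc (proj₂ u)
Adj⇒y≤1+y {u} {v} (_ , _ , dy) with ∣-∣≤1⇒Near (proj₂ u) (proj₂ v) dy
... | inj₁ refl = n≤1+n _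
... | inj₂ (inj₁ refl) = ≤-refl
... | inj₂ (inj₂ refl) = ≤-trans (n≤1+n _) (n≤1+n _)

around : ℕ → ℕ → List Pt
around x y = (x , y) ∷ (x , suc y) ∷ (x , suc (suc y)) ∷ (suc x , y) ∷ (suc x , suc (suc y)) ∷
             (suc (suc x) , y) ∷ (suc (suc x) , suc y) ∷ (suc (suc x) , suc (suc y)) ∷ []

Adj⇒∈around : ∀ x y v → Adj (suc x , suc y) v → v ∈ around x y
Adj⇒∈around x y (x' , y') (≢ , dx , dy) with ∣-∣≤1⇒Near (suc x) x' dx | ∣-∣≤1⇒Near (suc y) y' dy
... | inj₂ (inj₂ refl) | inj₂ (inj₂ refl) = here refl
... | inj₂ (inj₂ refl) | inj₁ refl = there (here refl)
... | inj₂ (inj₂ refl) | inj₂ (inj₁ refl) = there (there (here refl))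
... | inj₁ refl | inj₂ (inj₂ refl) = there (there (there (here refl)))
... | inj₁ refl | inj₁ refl = ⊥-elim (≢ refl)
... | inj₁ refl | inj₂ (inj₁ refl) = there (there (there (there (here refl))))
... | inj₂ (inj₁ refl) | inj₂ (inj₂ refl) = there (there (there (there (there (here refl)))))
... | inj₂ (inj₁ refl) | inj₁ refl = there (there (there (there (there (there (here refl))))))
... | inj₂ (inj₁ refl) | inj₂ (inj₁ refl) = there (there (there (there (there (there (there (here refl)))))))

NeighboursIn-around : ∀ {V : VSet} {x y L} →
  (V (x , y) → (x , y) ∈ L) → (V (x , suc y) → (x , suc y) ∈ L) →
  (V (x , suc (suc y)) → (x , suc (suc y)) ∈ L) → (V (suc x , y) → (suc x , y) ∈ L) →
  (V (suc x , suc (suc y)) → (suc x , suc (suc y)) ∈ L) → (V (suc (suc x) , y) → (suc (suc x) , y) ∈ L) →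
  (V (suc (suc x) , suc y) → (suc (suc x) , suc y) ∈ L) →
  (V (suc (suc x) , suc (suc y)) → (suc (suc x) , suc (suc y)) ∈ L) →
  NeighboursIn V (suc x , suc y) L
NeighboursIn-around {x = x} {y} f₁ f₂ f₃ f₄ f₅ f₆ f₇ f₈ v Vv a with Adj⇒∈around x y v a
... | here refl = f₁ Vv
... | there (here refl) = f₂ Vv
... | there (there (here refl)) = f₃ Vv
... | there (there (there (here refl))) = f₄ Vv
... | there (there (there (there (here refl)))) = f₅ Vv
... | there (there (there (there (there (here refl))))) = f₆ Vv
... | there (there (there (there (there (there (here refl)))))) = f₇ Vv
... | there (there (there (there (there (there (there (here refl))))))) = f₈ Vv

module InC-bounds (m n k l c : ℕ) where

  off-left : ∀ {y} {A : Set} → InC m n k l c (0 , y) → A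
  off-left ((() , _) , _)

  off-bottom : ∀ {x} {A : Set} → InC m n k l c (x , 0) → A
  off-bottom ((_ , _ , () , _) , _)

  off-right : ∀ {y} {A : Set} → InC m n k l c (suc m , y) → A
  off-right ((_ , x≤m , _) , _) = ⊥-elim (1+n≰n x≤m)

  off-top : ∀ {x} {A : Set} → InC m n k l c (x , suc n) → A
  off-top ((_ , _ , _ , y≤n) , _) = ⊥-elim (1+n≰n y≤n)

  in-notch : ∀ {x y} {A : Set} → InC m n k l c (x , y)
           → (m ∸ k) + 1 ≤ x → x ≤ m → c + 1 ≤ y → y ≤ c + l → A
  in-notch (_ , ∉notch) p q r s = ⊥-elim (∉notch (p , q , r , s))

Rows1∧3 : ℕ → ℕ → Set
Rows1∧3 y y' = (y ≡ 1 × y' ≡ 3) ⊎ (y ≡ 3 × y' ≡ 1)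

∣-∣≡2-in-[1,3] : ∀ {x y} → 1 ≤ x → x ≤ 3 → 1 ≤ y → y ≤ 3 → ∣ x - y ∣ ≡ 2 → Rows1∧3 x y
∣-∣≡2-in-[1,3] {1} {3} _ _ _ _ _ = inj₁ (refl , refl)
∣-∣≡2-in-[1,3] {3} {1} _ _ _ _ _ = inj₂ (refl , refl)
∣-∣≡2-in-[1,3] {0} () _ _ _ _
∣-∣≡2-in-[1,3] {suc (suc (suc (suc _)))} _ (s≤s (s≤s (s≤s ()))) _ _ _
∣-∣≡2-in-[1,3] {_} {0} _ _ () _ _
∣-∣≡2-in-[1,3] {_} {suc (suc (suc (suc _)))} _ _ _ (s≤s (s≤s (s≤s ()))) _
∣-∣≡2-in-[1,3] {1} {1} _ _ _ _ ()
∣-∣≡2-in-[1,3] {1} {2} _ _ _ _ ()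
∣-∣≡2-in-[1,3] {2} {1} _ _ _ _ ()
∣-∣≡2-in-[1,3] {2} {2} _ _ _ _ ()
∣-∣≡2-in-[1,3] {2} {3} _ _ _ _ ()
∣-∣≡2-in-[1,3] {3} {2} _ _ _ _ ()
∣-∣≡2-in-[1,3] {3} {3} _ _ _ _ ()

-- C(a+1, 3; 1, 1; 1, 1): the notch is the single cell (a+1, 2).
ThinC : ℕ → VSet
ThinC a = InC (suc a) 3 1 1 1

ThinC-∣Δy∣≡2 : ∀ {a x y x' y'} → ThinC a (x , y) → ThinC a (x' , y') → ∣ y - y' ∣ ≡ 2 → Rows1∧3 y y'
ThinC-∣Δy∣≡2 ((_ , _ , 1≤y , y≤3) , _) ((_ , _ , 1≤y' , y'≤3) , _) = ∣-∣≡2-in-[1,3] 1≤y y≤3 1≤y' y'≤3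

module ThinC-points (a : ℕ) where
  open InC-bounds (suc a) 3 1 1 1

  notch : ∀ {A : Set} → ThinC a (suc a , 2) → A
  notch v = in-notch v (≤-reflexive (+-comm a 1)) ≤-refl ≤-refl ≤-refl

  bottom-row∈ : ∀ {x} → 1 ≤ x → x ≤ suc a → ThinC a (x , 1)
  bottom-row∈ 1≤x x≤m = (1≤x , x≤m , s≤s z≤n , s≤s z≤n) , λ { (_ , _ , s≤s () , _) }

  top-row∈ : ∀ {x} → 1 ≤ x → x ≤ suc a → ThinC a (x , 3)
  top-row∈ 1≤x x≤m = (1≤x , x≤m , s≤s z≤n , ≤-refl) , λ { (_ , _ , _ , s≤s (s≤s ())) }

  left-lower-corner : NeighboursIn (ThinC a) (1 , 1) ((1 , 2) ∷ (2 , 2) ∷ (2 , 1) ∷ [])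
  left-lower-corner = NeighboursIn-around off-left off-left off-left off-bottom (λ _ → here refl)
                        off-bottom (λ _ → there (there (here refl))) (λ _ → there (here refl))

  left-upper-corner : NeighboursIn (ThinC a) (1 , 3) ((1 , 2) ∷ (2 , 2) ∷ (2 , 3) ∷ [])
  left-upper-corner = NeighboursIn-around off-left off-left off-left (λ _ → here refl) off-top
                        (λ _ → there (here refl)) (λ _ → there (there (here refl))) off-top

  lower-corner : NeighboursIn (ThinC a) (suc a , 1) ((a , 1) ∷ (a , 2) ∷ [])
  lower-corner = NeighboursIn-around off-bottom (λ _ → here refl) (λ _ → there (here refl))
                   off-bottom notch off-bottom off-right off-right

  upper-corner : NeighboursIn (ThinC a) (suc a , 3) ((a , 2) ∷ (a , 3) ∷ [])
  upper-corner = NeighboursIn-around (λ _ → here refl) (λ _ → there (here refl)) off-top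
                   notch off-top off-right off-right off-right

¬F8₁ : ∀ a {y y'} → 2 ≤ a → HamiltonianOrder (ThinC a) (a , y) (a , y') → ¬ Rows1∧3 y y'
¬F8₁ 1 (s≤s ()) _ _
¬F8₁ a@(suc (suc _)) _ H (inj₁ (refl , refl)) =
  All¬⇒¬Any ((λ ()) ∷ (λ ()) ∷ (λ ()) ∷ (λ ()) ∷ (λ ()) ∷ [])
    (F8₁-pattern-covers (bottom-row∈ (s≤s z≤n) ≤-refl , (λ ()) , λ ())
                        (top-row∈ (s≤s z≤n) ≤-refl , (λ ()) , λ ())
                        lower-corner upper-corner (1 , 1) (bottom-row∈ ≤-refl (s≤s z≤n)))
  where
  open OrderFacts H
  open ThinC-points a
¬F8₁ a@(suc (suc _)) _ H (inj₂ (refl , refl)) =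
  All¬⇒¬Any ((λ ()) ∷ (λ ()) ∷ (λ ()) ∷ (λ ()) ∷ (λ ()) ∷ [])
    (F8₁-pattern-covers (top-row∈ (s≤s z≤n) ≤-refl , (λ ()) , λ ())
                        (bottom-row∈ (s≤s z≤n) ≤-refl , (λ ()) , λ ())
                        (NeighboursIn-swap upper-corner) (NeighboursIn-swap lower-corner)
                        (1 , 1) (bottom-row∈ ≤-refl (s≤s z≤n)))
  where
  open OrderFacts H
  open ThinC-points a

¬F8₂ : ∀ {y y'} → HamiltonianOrder (ThinC 2) (1 , y) (2 , y') → ¬ Rows1∧3 y y'
¬F8₂ H (inj₁ (refl , refl)) =
  F8₂-pattern-impossible (top-row∈ (s≤s z≤n) ≤-refl , (λ ()) , λ ())
                         (bottom-row∈ (s≤s z≤n) ≤-refl , (λ ()) , λ ())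
                         (top-row∈ ≤-refl (s≤s z≤n) , (λ ()) , λ ())
                         (λ ()) (λ ()) (λ ()) upper-corner lower-corner left-upper-corner
  where
  open OrderFacts H
  open ThinC-points 2
¬F8₂ H (inj₂ (refl , refl)) =
  F8₂-pattern-impossible (bottom-row∈ (s≤s z≤n) ≤-refl , (λ ()) , λ ())
                         (top-row∈ (s≤s z≤n) ≤-refl , (λ ()) , λ ())
                         (bottom-row∈ ≤-refl (s≤s z≤n) , (λ ()) , λ ())
                         (λ ()) (λ ()) (λ ()) (NeighboursIn-swap lower-corner)
                         (NeighboursIn-swap upper-corner) left-lower-corner
  where
  open OrderFacts H
  open ThinC-points 2

¬F8₃ : ∀ a {s} → proj₁ s < a → ¬ HamiltonianOrder (ThinC a) s (a , 2)
¬F8₃ a {s} sx<a H = lower≢upper (↦-injective (proj₂ (↦end lower lower-corner))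
                                              (proj₂ (↦end upper (NeighboursIn-swap upper-corner))))
  where
  open OrderFacts H
  open ThinC-points a
  right-column≢s : ∀ {y} → (suc a , y) ≢ s
  right-column≢s e = 1+n≰n (≤-trans (n≤1+n _) (subst (_< a) (sym (cong proj₁ e)) sx<a))
  lower : Internal (suc a , 1)
  lower = bottom-row∈ (s≤s z≤n) ≤-refl , right-column≢s , λ ()
  upper : Internal (suc a , 3)
  upper = top-row∈ (s≤s z≤n) ≤-refl , right-column≢s , λ ()
  lower≢upper : (suc a , 1) ≢ (suc a , 3)
  lower≢upper ()

¬F8 : ∀ m n k l c {s t} → k < m → l + c < n → InC m n k l c s → InC m n k l c t
    → HamiltonianOrder (InC m n k l c) s t → ¬ F8 m n k l c s t
¬F8 (suc a) _ _ 1 _ {_ , _} {_ , _} _ _ Gs Gt H (refl , refl , refl , _ , inj₁ (2≤a , refl , refl , dist)) =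
  ¬F8₁ a 2≤a H (ThinC-∣Δy∣≡2 {a} Gs Gt dist)
¬F8 (suc a) _ _ 1 _ {_ , _} {_ , _} _ _ Gs Gt H (refl , refl , refl , _ , inj₂ (inj₁ (refl , refl , refl , dist))) =
  ¬F8₂ H (ThinC-∣Δy∣≡2 {a} Gs Gt dist)
¬F8 (suc a) _ _ 1 _ _ _ _ _ H (refl , refl , refl , _ , inj₂ (inj₂ (_ , sx<a , refl))) = ¬F8₃ a sx<a H
¬F8 _ _ _ (suc (suc l)) _ _ (s≤s (s≤s (s≤s l+1≤0))) _ _ _ (refl , _ , refl , _) =
  1+n≰n (≤-trans (m≤n+m 1 l) l+1≤0)

module F7-bottom (n l : ℕ) (1≤l : 1 ≤ l) (3≤n : 3 ≤ n) where
  V : VSet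
  V = InC 3 n 1 l 1
  open InC-bounds 3 n 1 l 1

  bottom-row∈ : ∀ {x} → 1 ≤ x → x ≤ 3 → V (x , 1)
  bottom-row∈ 1≤x x≤3 = (1≤x , x≤3 , s≤s z≤n , ≤-trans (s≤s z≤n) 3≤n) , λ { (_ , _ , s≤s () , _) }

  left-column∈ : ∀ {y} → 1 ≤ y → y ≤ n → V (1 , y)
  left-column∈ 1≤y y≤n = (s≤s z≤n , s≤s z≤n , 1≤y , y≤n) , λ { (s≤s () , _) }

  notch-corner : ∀ {A : Set} → V (3 , 2) → A
  notch-corner v = in-notch v ≤-refl ≤-refl ≤-refl (s≤s 1≤l)

  arm-tip : NeighboursIn V (3 , 1) ((2 , 1) ∷ (2 , 2) ∷ [])
  arm-tip = NeighboursIn-around off-bottom (λ _ → here refl) (λ _ → there (here refl))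
              off-bottom notch-corner off-bottom off-right off-right

  arm-middle : NeighboursIn V (2 , 1) ((1 , 1) ∷ (3 , 1) ∷ (1 , 2) ∷ (2 , 2) ∷ [])
  arm-middle = NeighboursIn-around off-bottom (λ _ → here refl) (λ _ → there (there (here refl)))
                 off-bottom (λ _ → there (there (there (here refl)))) off-bottom (λ _ → there (here refl))
                 notch-corner

  origin : NeighboursIn V (1 , 1) ((2 , 1) ∷ (1 , 2) ∷ (2 , 2) ∷ [])
  origin = NeighboursIn-around off-left off-left off-left off-bottom (λ _ → there (here refl))
             off-bottom (λ _ → here refl) (λ _ → there (there (here refl)))

  ¬F7-bottom : ∀ {s t} → proj₁ s ≤ proj₁ t → HamiltonianOrder V s t
             → ¬ (PairEq s t (1 , 1) (2 , 2) ⊎ PairEq s t (1 , 2) (2 , 1))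
  ¬F7-bottom (s≤s ()) _ (inj₁ (inj₂ (refl , refl)))
  ¬F7-bottom (s≤s ()) _ (inj₂ (inj₂ (refl , refl)))
  ¬F7-bottom _ H (inj₁ (inj₁ (refl , refl))) =
    [ All¬⇒¬Any ((λ ()) ∷ (λ ()) ∷ (λ ()) ∷ (λ ()) ∷ [])
    , All¬⇒¬Any ((λ ()) ∷ (λ ()) ∷ (λ ()) ∷ (λ ()) ∷ (λ ()) ∷ []) ]′
      (F7₁-pattern-covers (λ ()) (bottom-row∈ (s≤s z≤n) ≤-refl , (λ ()) , λ ())
                          (bottom-row∈ (s≤s z≤n) (s≤s (s≤s z≤n)) , (λ ()) , λ ()) (λ ())
                          arm-tip origin arm-middle (1 , 3) (left-column∈ (s≤s z≤n) 3≤n))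
    where open OrderFacts H
  ¬F7-bottom _ H (inj₂ (inj₁ (refl , refl))) =
    All¬⇒¬Any ((λ ()) ∷ (λ ()) ∷ (λ ()) ∷ (λ ()) ∷ (λ ()) ∷ [])
      (F7₂-pattern-covers (bottom-row∈ (s≤s z≤n) ≤-refl , (λ ()) , λ ())
                          (bottom-row∈ ≤-refl (s≤s z≤n) , (λ ()) , λ ()) (λ ())
                          (NeighboursIn-swap arm-tip) origin (1 , 3) (left-column∈ (s≤s z≤n) 3≤n))
    where open OrderFacts H

module F7-top (l c : ℕ) (1≤l : 1 ≤ l) (1≤c : 1 ≤ c) where
  T : ℕ
  T = c + l

  V : VSet
  V = InC 3 (suc T) 1 l c
  open InC-bounds 3 (suc T) 1 l c

  2≤T : 2 ≤ T
  2≤T = +-mono-≤ 1≤c 1≤l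

  top-row∈ : ∀ {x} → 1 ≤ x → x ≤ 3 → V (x , suc T)
  top-row∈ 1≤x x≤3 = (1≤x , x≤3 , s≤s z≤n , ≤-refl) , λ (_ , _ , _ , 1+T≤T) → 1+n≰n 1+T≤T

  origin∈ : V (1 , 1)
  origin∈ = (s≤s z≤n , s≤s z≤n , s≤s z≤n , s≤s z≤n) , λ { (s≤s () , _) }

  origin≢ : ∀ {x y} → 2 ≤ y → (1 , 1) ≢ (x , y)
  origin≢ (s≤s ()) refl

  1+T≢T : ∀ {x x' : ℕ} → (x , suc T) ≢ (x' , T)
  1+T≢T e = 1+n≢n (cong proj₂ e)

  notch-corner : ∀ {A : Set} → V (3 , T) → A
  notch-corner v = in-notch v ≤-refl ≤-refl (+-monoʳ-≤ c 1≤l) ≤-refl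

  arm-tip : NeighboursIn V (3 , suc T) ((2 , suc T) ∷ (2 , T) ∷ [])
  arm-tip = NeighboursIn-around (λ _ → there (here refl)) (λ _ → here refl) off-top
              notch-corner off-top off-right off-right off-right

  arm-middle : NeighboursIn V (2 , suc T) ((1 , suc T) ∷ (3 , suc T) ∷ (1 , T) ∷ (2 , T) ∷ [])
  arm-middle = NeighboursIn-around (λ _ → there (there (here refl))) (λ _ → here refl) off-top
                 (λ _ → there (there (there (here refl)))) off-top notch-corner (λ _ → there (here refl))
                 off-top

  corner : NeighboursIn V (1 , suc T) ((2 , suc T) ∷ (1 , T) ∷ (2 , T) ∷ [])
  corner = NeighboursIn-around off-left off-left off-left (λ _ → there (here refl)) off-top
             (λ _ → there (there (here refl))) (λ _ → here refl) off-top

  ¬F7-top : ∀ {s t} → proj₁ s ≤ proj₁ t → HamiltonianOrder V s t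
          → ¬ (PairEq s t (1 , suc T) (2 , T) ⊎ PairEq s t (1 , T) (2 , suc T))
  ¬F7-top (s≤s ()) _ (inj₁ (inj₂ (refl , refl)))
  ¬F7-top (s≤s ()) _ (inj₂ (inj₂ (refl , refl)))
  ¬F7-top _ H (inj₁ (inj₁ (refl , refl))) =
    [ All¬⇒¬Any (origin≢ 2≤1+T ∷ origin≢ 2≤1+T ∷ origin≢ 2≤1+T ∷ origin≢ 2≤T ∷ [])
    , All¬⇒¬Any (origin≢ 2≤1+T ∷ origin≢ 2≤T ∷ origin≢ 2≤1+T ∷ origin≢ 2≤1+T ∷ origin≢ 2≤T ∷ []) ]′
      (F7₁-pattern-covers (λ ()) (top-row∈ (s≤s z≤n) ≤-refl , (λ ()) , λ ())
                          (top-row∈ (s≤s z≤n) (s≤s (s≤s z≤n)) , (λ ()) , 1+T≢T) (λ ())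
                          arm-tip corner arm-middle (1 , 1) origin∈)
    where
    open OrderFacts H
    2≤1+T = ≤-trans 2≤T (n≤1+n T)
  ¬F7-top _ H (inj₂ (inj₁ (refl , refl))) =
    All¬⇒¬Any (origin≢ 2≤T ∷ origin≢ 2≤1+T ∷ origin≢ 2≤T ∷ origin≢ 2≤1+T ∷ origin≢ 2≤1+T ∷ [])
      (F7₂-pattern-covers (top-row∈ (s≤s z≤n) ≤-refl , (λ ()) , λ ())
                          (top-row∈ (s≤s z≤n) (s≤s z≤n) , 1+T≢T , λ ()) (λ ())
                          (NeighboursIn-swap arm-tip) corner (1 , 1) origin∈)
    where
    open OrderFacts H
    2≤1+T = ≤-trans 2≤T (n≤1+n T)

d≡1⇒n≡1+c+l : ∀ {n l c} → l + c < n → n ∸ (l + c) ≡ 1 → n ≡ suc (c + l)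
d≡1⇒n≡1+c+l {n} {l} {c} l+c<n d≡1 = begin
  n                      ≡⟨ m∸n+n≡m (<⇒≤ l+c<n) ⟨
  n ∸ (l + c) + (l + c)  ≡⟨ cong (_+ (l + c)) d≡1 ⟩
  suc (l + c)            ≡⟨ cong suc (+-comm l c) ⟩
  suc (c + l)            ∎
  where open ≡-Reasoning

¬F7 : ∀ m n k l c {s t} → 1 ≤ l → 1 ≤ c → 3 ≤ n → k < m → l + c < n → proj₁ s ≤ proj₁ t
    → HamiltonianOrder (InC m n k l c) s t → ¬ F7 m n k l c s t
¬F7 _ n 1 l _ 1≤l _ 3≤n _ _ sx≤tx H (refl , refl , inj₁ (refl , ends)) =
  F7-bottom.¬F7-bottom n l 1≤l 3≤n sx≤tx H ends
¬F7 _ n 1 l c 1≤l 1≤c _ _ l+c<n sx≤tx H (refl , refl , inj₂ (d≡1 , ends))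
  with refl ← d≡1⇒n≡1+c+l {l = l} {c} l+c<n d≡1 = F7-top.¬F7-top l c 1≤l 1≤c sx≤tx H ends
¬F7 _ _ 0 _ _ _ _ _ _ _ _ _ (refl , () , _)
¬F7 _ _ 2 _ _ _ _ _ _ _ _ _ (refl , () , _)
¬F7 _ _ (suc (suc (suc k))) _ _ _ _ _ k<m _ _ _ (refl , _ , _) = <⇒≱ k<m (m≤m+n 3 k)

-- With a = 1, the column x = 1 is the only connection between the two arms of the C.
module NarrowSpine (m n k l c : ℕ) (a≡1 : m ∸ k ≡ 1) (2≤m : 2 ≤ m) (1≤l : 1 ≤ l) (1≤c : 1 ≤ c)
                   (l+c<n : l + c < n) where
  V : VSet
  V = InC m n k l c

  left-column∈ : ∀ {y} → 1 ≤ y → y ≤ n → V (1 , y)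
  left-column∈ 1≤y y≤n = (s≤s z≤n , ≤-trans (s≤s z≤n) 2≤m , 1≤y , y≤n) ,
                         λ (a+1≤1 , _) → 1+n≰n (subst (λ a → a + 1 ≤ 1) a≡1 a+1≤1)

  beside-notch⇒x≡1 : ∀ {x y} → V (x , y) → c + 1 ≤ y → y ≤ c + l → x ≡ 1
  beside-notch⇒x≡1 {0} ((() , _) , _) _ _
  beside-notch⇒x≡1 {1} _ _ _ = refl
  beside-notch⇒x≡1 {suc (suc x)} ((_ , x≤m , _) , ∉notch) p q =
    ⊥-elim (∉notch (subst (λ a → a + 1 ≤ suc (suc x)) (sym a≡1) (s≤s (s≤s z≤n)) , x≤m , p , q))

  ¬ends-below : ∀ {s t} → HamiltonianOrder V s t → proj₂ s ≤ c → proj₂ t ≤ c → ⊥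
  ¬ends-below H Lo-s Lo-t =
    ends-on-one-side⇒other-side-empty Lo Up (1 , suc c) (left-column∈ (s≤s z≤n) 1+c≤n) split
      1+n≰n 1+n≰n Lo∩Up no-edge Lo-s Lo-t (1 , n) (left-column∈ (≤-trans (s≤s z≤n) 2+c≤n) ≤-refl) 2+c≤n
    where
    open OrderFacts H
    Lo Up : Pt → Set
    Lo v = proj₂ v ≤ c
    Up v = suc (suc c) ≤ proj₂ v
    2+c≤n : suc (suc c) ≤ n
    2+c≤n = ≤-trans (s≤s (+-monoˡ-≤ c 1≤l)) l+c<n
    1+c≤n : suc c ≤ n
    1+c≤n = ≤-trans (n≤1+n _) 2+c≤n
    split : ∀ v → V v → Lo v ⊎ v ≡ (1 , suc c) ⊎ Up v
    split (x , y) Vv with <-cmp y (suc c)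
    ... | tri< y<1+c _ _ = inj₁ (s≤s⁻¹ y<1+c)
    ... | tri≈ _ refl _ = inj₂ (inj₁ (cong (_, suc c)
            (beside-notch⇒x≡1 Vv (≤-reflexive (+-comm c 1)) (subst (_≤ c + l) (+-comm c 1) (+-monoʳ-≤ c 1≤l)))))
    ... | tri> _ _ 1+c<y = inj₂ (inj₂ 1+c<y)
    Lo∩Up : ∀ v → Lo v → ¬ Up v
    Lo∩Up _ y≤c 2+c≤y = 1+n≰n (≤-trans (n≤1+n _) (≤-trans 2+c≤y y≤c))
    no-edge : ∀ u v → Adj u v → Lo u → ¬ Up v
    no-edge u v adj y≤c 2+c≤y = 1+n≰n (≤-trans 2+c≤y (≤-trans (Adj⇒y≤1+y adj) (s≤s y≤c)))

  ¬ends-above : ∀ {s t} → HamiltonianOrder V s t → c + l < proj₂ s → c + l < proj₂ t → ⊥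
  ¬ends-above H Lo-s Lo-t =
    ends-on-one-side⇒other-side-empty Lo Up (1 , c + l) (left-column∈ 1≤c+l c+l≤n)
      split 1+n≰n 1+n≰n Lo∩Up no-edge Lo-s Lo-t (1 , 1) (left-column∈ ≤-refl (≤-trans 1≤c+l c+l≤n))
      (+-mono-≤ 1≤c 1≤l)
    where
    open OrderFacts H
    Lo Up : Pt → Set
    Lo v = suc (c + l) ≤ proj₂ v
    Up v = suc (proj₂ v) ≤ c + l
    1≤c+l : 1 ≤ c + l
    1≤c+l = ≤-trans 1≤c (m≤m+n c l)
    c+l≤n : c + l ≤ n
    c+l≤n = ≤-trans (≤-reflexive (+-comm c l)) (<⇒≤ l+c<n)
    split : ∀ v → V v → Lo v ⊎ v ≡ (1 , c + l) ⊎ Up v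
    split (x , y) Vv with <-cmp y (c + l)
    ... | tri< y<c+l _ _ = inj₂ (inj₂ y<c+l)
    ... | tri≈ _ refl _ = inj₂ (inj₁ (cong (_, c + l) (beside-notch⇒x≡1 Vv (+-monoʳ-≤ c 1≤l) ≤-refl)))
    ... | tri> _ _ c+l<y = inj₁ c+l<y
    Lo∩Up : ∀ v → Lo v → ¬ Up v
    Lo∩Up _ c+l<y y<c+l = 1+n≰n (≤-trans (n≤1+n _) (≤-trans (s≤s c+l<y) y<c+l))
    no-edge : ∀ u v → Adj u v → Lo u → ¬ Up v
    no-edge u v adj c+l<y y<c+l = 1+n≰n (≤-trans c+l<y (≤-trans (Adj⇒y≤1+y (Adj-sym adj)) y<c+l))

¬F9 : ∀ m n k l c {s t} → 2 ≤ m → 1 ≤ l → 1 ≤ c → l + c < n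
    → HamiltonianOrder (InC m n k l c) s t → ¬ F9 m n k l c s t
¬F9 m n k l c 2≤m 1≤l 1≤c l+c<n H (a≡1 , inj₁ (s-below , t-below)) =
  NarrowSpine.¬ends-below m n k l c a≡1 2≤m 1≤l 1≤c l+c<n H s-below t-below
¬F9 m n k l c 2≤m 1≤l 1≤c l+c<n H (a≡1 , inj₂ (s-above , t-above)) =
  NarrowSpine.¬ends-above m n k l c a≡1 2≤m 1≤l 1≤c l+c<n H s-above t-above

lemma7 : (m n k l c : ℕ) → 2 ≤ m → 3 ≤ n → 1 ≤ k → 1 ≤ l → 1 ≤ c
       → k < m → l + c < n
       → (s t : Pt) → InC m n k l c s → InC m n k l c t → s ≢ t
       → proj₁ s ≤ proj₁ t
       → HamPath (InC m n k l c) s t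
       → ¬ F1 m n k l c s t × ¬ F3 m n k l c s t × ¬ F7 m n k l c s t
         × ¬ F8 m n k l c s t × ¬ F9 m n k l c s t
lemma7 m n k l c 2≤m 3≤n _ 1≤l 1≤c k<m l+c<n s t Gs Gt s≢t sx≤tx ham =
  ¬F1 , ¬internal-degree1 , ¬F7 m n k l c 1≤l 1≤c 3≤n k<m l+c<n sx≤tx H ,
  ¬F8 m n k l c k<m l+c<n Gs Gt H , ¬F9 m n k l c 2≤m 1≤l 1≤c l+c<n H
  where
  H : HamiltonianOrder (InC m n k l c) s t
  H = hamPath⇒order ham
  open OrderFacts H
  ¬F1 : ¬ F1 m n k l c s t
  ¬F1 (inj₁ (_ , disconnected)) = disconnected (connected-without-start s≢t)
  ¬F1 (inj₂ (inj₁ (_ , disconnected))) = disconnected (connected-without-end s≢t)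
  ¬F1 (inj₂ (inj₂ disconnected)) = disconnected (connected-without-ends s≢t)
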